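{- For any finite tree $T$, ${\rm dmg}(T)={\rm rad}(T)-1$.
   Context: ${\rm rad}$ denotes the radius of a graph. Damage game on a graph: one cop and one robber; in round $0$ the cop chooses a vertex, then the robber does; in each later round the cop moves to an adjacent vertex or passes, then the robber moves to an adjacent vertex or passes; the robber is captured if the cop occupies the robber's vertex. A vertex $v$ is damaged if the robber occupies $v$ in some round $i\ge0$ and in round $i+1$ the uncaptured robber passes or moves to a neighbour. The damage number ${\rm dmg}(\cdot)$ is the number of distinct vertices damaged when the cop plays to minimize and the robber to maximize this number. -}

module Defs where

open import Data.Nat using (ℕ; zero; suc; _≤_; _<_; _∸_)
open import Data.Fin using (Fin)
open import Data.Bool using (Bool; true; false; T)
open import Data.Product using (Σ; ∃; ∃-syntax; _×_; _,_; proj₁; proj₂)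
open import Data.Sum using (_⊎_)
open import Data.List using (List; []; _∷_; _∷ʳ_; length)
open import Data.List.Relation.Unary.Linked using (Linked)
open import Data.List.Relation.Unary.Unique.Propositional using (Unique)
open import Data.List.Relation.Unary.All using (All)
open import Data.List.Membership.Propositional using (_∈_)
open import Data.Vec using (Vec; last) renaming ([] to []ᵥ; _∷_ to _∷ᵥ_; _∷ʳ_ to _∷ʳᵥ_)
open import Relation.Binary.PropositionalEquality using (_≡_; _≢_)
open import Relation.Nullary using (¬_)

record Graph : Set where
  field
    n      : ℕ
    adj    : Fin n → Fin n → Bool
    sym    : ∀ u v → adj u v ≡ adj v u
    irrefl : ∀ v → adj v v ≡ false

module _ (G : Graph) where
  open Graph G

  V : Set
  V = Fin n

  Adj : V → V → Set
  Adj u v = T (adj u v)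

  data Walk : V → V → ℕ → Set where
    nil  : ∀ {u} → Walk u u 0
    cons : ∀ {u w v k} → Adj u w → Walk w v k → Walk u v (suc k)

  Connected : Set
  Connected = ∀ u v → ∃[ k ] Walk u v k

  HasCycle : Set
  HasCycle = ∃[ x ] ∃[ ys ] (2 ≤ length ys × Unique (x ∷ ys) × Linked Adj ((x ∷ ys) ∷ʳ x))

  Acyclic : Set
  Acyclic = ¬ HasCycle

  IsTree : Set
  IsTree = (1 ≤ n) × Connected × Acyclic

  IsDist : V → V → ℕ → Set
  IsDist u v d = Walk u v d × (∀ k → k < d → ¬ Walk u v k)

  IsEcc : V → ℕ → Set
  IsEcc v e = (∀ u → ∃[ d ] (d ≤ e × IsDist v u d)) × (∃[ u ] IsDist v u e)

  IsRadius : ℕ → Set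
  IsRadius r = (∃[ v ] IsEcc v r) × (∀ v e → IsEcc v e → r ≤ e)

  Step : V → V → Set
  Step u v = u ≡ v ⊎ Adj u v

  -- A (deterministic, full-information) cop strategy.  In round i+1 the cop
  -- sees the cop positions of rounds 0..i and robber positions of rounds 0..i.
  record CopStrategy : Set where
    field
      start : V
      move  : (i : ℕ) → Vec V (suc i) → Vec V (suc i) → V
      legal : ∀ i cs rs → Step (last cs) (move i cs rs)

  -- A robber strategy.  In round 0 the robber sees the cop's start; in round
  -- i+1 it sees cop positions of rounds 0..i+1 and its own of rounds 0..i.
  record RobberStrategy : Set where
    field
      start : V → V
      move  : (i : ℕ) → Vec V (suc (suc i)) → Vec V (suc i) → V
      legal : ∀ i cs rs → Step (last rs) (move i cs rs)

  module Play (C : CopStrategy) (R : RobberStrategy) where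
    private
      module C = CopStrategy C
      module R = RobberStrategy R

    history : (i : ℕ) → Vec V (suc i) × Vec V (suc i)
    history zero = (C.start ∷ᵥ []ᵥ) , (R.start C.start ∷ᵥ []ᵥ)
    history (suc i) =
      let cs = proj₁ (history i)
          rs = proj₂ (history i)
          cs' = cs ∷ʳᵥ C.move i cs rs
      in cs' , (rs ∷ʳᵥ R.move i cs' rs)

    cop : ℕ → V
    cop i = last (proj₁ (history i))

    robber : ℕ → V
    robber i = last (proj₂ (history i))

    -- v is damaged: the robber occupies v in round i, has not been captured
    -- in rounds 0..i, and is not captured by the cop's move in round i+1
    -- (so the uncaptured robber passes or moves in round i+1).
    Damaged : V → Set
    Damaged v = ∃[ i ] (robber i ≡ v
                        × (∀ j → j ≤ i → cop j ≢ robber j)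
                        × cop (suc i) ≢ robber i)

  AtMostDamaged : CopStrategy → RobberStrategy → ℕ → Set
  AtMostDamaged C R k =
    ∃[ L ] (length L ≤ k × (∀ v → Play.Damaged C R v → v ∈ L))

  AtLeastDamaged : CopStrategy → RobberStrategy → ℕ → Set
  AtLeastDamaged C R k =
    ∃[ L ] (length L ≡ k × Unique L × All (Play.Damaged C R) L)

  -- dmg(G) = k : min over cop strategies of max over robber strategies
  -- of the number of damaged vertices equals k
  DmgIs : ℕ → Set
  DmgIs k = (∃[ C ] ∀ R → AtMostDamaged C R k)
          × (∀ C → ∃[ R ] AtLeastDamaged C R k)

-- Upper bound: the cop starts at a centre c and always steps one level down, in the
-- breadth-first tree rooted at c, towards the robber.  Acyclicity makes the levels of
-- adjacent vertices differ by one and parents unique, so the robber can never leave the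
-- cop's subtree: it is caught, stays next to the cop, or is in that subtree with the cop
-- at level i in round i.  Damage in round i needs the robber two levels below the cop,
-- hence i + 2 ≤ rad, and at most rad − 1 rounds (so vertices) are damaged.
-- Lower bound: against a cop starting at v, the robber runs along a shortest walk from v
-- to a vertex at distance ecc(v) ≥ rad, starting two steps out.  In round j the cop is
-- within distance j of v, so it never reaches the runner, which damages the rad − 1
-- distinct vertices at distances 2, …, rad along the walk.

module Submission where

open import Defs
open import Data.Nat using (ℕ; zero; suc; _+_; _∸_; _≤_; _<_; z≤n; s≤s)
open import Data.Nat.Properties
open import Data.Nat.Induction using (<-wellFounded)
open import Induction.WellFounded using (Acc; acc)
open import Data.Fin using (Fin) renaming (_≟_ to _≟ᶠ_)
open import Data.Fin.Properties using (any?)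
open import Data.Bool using (T)
open import Data.Bool.Properties using (T?)
open import Data.Product using (∃-syntax; _×_; _,_; proj₁; proj₂)
open import Data.Sum using (_⊎_; inj₁; inj₂)
open import Data.Empty using (⊥; ⊥-elim)
open import Data.Vec using (last)
open import Data.Vec.Properties using (last-∷ʳ)
open import Data.List using (List; []; _∷_; _∷ʳ_; length; allFin; applyUpTo)
open import Data.List.Properties using (length-applyUpTo)
open import Data.List.Extrema.Nat using (argmax; f[xs]≤f[argmax])
open import Data.List.Membership.Propositional.Properties using (∈-allFin; ∈-applyUpTo⁺)
open import Data.List.Relation.Unary.All as All using (All; []; _∷_)
open import Data.List.Relation.Unary.All.Properties using (∷ʳ⁺; applyUpTo⁺₁)
open import Data.List.Relation.Unary.AllPairs using ([]; _∷_)
open import Data.List.Relation.Unary.Any using (here)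
open import Data.List.Relation.Unary.Linked using (Linked; [-]; _∷_)
open import Data.List.Relation.Unary.Unique.Propositional using (Unique)
import Data.List.Relation.Unary.Unique.Propositional.Properties as Unique
open import Relation.Binary.PropositionalEquality
open import Relation.Binary.Definitions using (tri<; tri≈; tri>)
open import Relation.Nullary using (¬_; Dec; yes; no)
open import Relation.Nullary.Decidable using (_×-dec_; _⊎-dec_)
open import Relation.Unary using (Decidable)
open import Function using (_∘_)

least-witness : {P : ℕ → Set} → Decidable P → ∀ {k} → P k →
                ∃[ d ] (P d × (∀ j → j < d → ¬ P j))
least-witness {P} P? {k} = go k (<-wellFounded k)
  where
  go : ∀ k → Acc _<_ k → P k → ∃[ d ] (P d × (∀ j → j < d → ¬ P j))
  go k (acc rec) pk with anyUpTo? P? k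
  ... | yes (j , j<k , pj) = go j (rec j<k) pj
  ... | no none            = k , pk , λ j j<k pj → none (j , j<k , pj)

<∸1⇒2+≤ : ∀ {i e} → i < e ∸ 1 → 2 + i ≤ e
<∸1⇒2+≤ {e = suc e} i<e = s≤s i<e

2+≤⇒<∸1 : ∀ {i e} → 2 + i ≤ e → i < e ∸ 1
2+≤⇒<∸1 {e = suc e} (s≤s 1+i≤e) = 1+i≤e

module Walks (G : Graph) where
  open Graph G using (n; adj; irrefl) renaming (sym to adj-sym)

  Adj-sym : ∀ {u v} → Adj G u v → Adj G v u
  Adj-sym {u} {v} = subst T (adj-sym u v)

  Adj-irrefl : ∀ {u} → ¬ Adj G u u
  Adj-irrefl {u} = subst T (irrefl u)

  Step? : ∀ u v → Dec (Step G u v)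
  Step? u v = (u ≟ᶠ v) ⊎-dec T? (adj u v)

  _▻_ : ∀ {u v w k} → Walk G u v k → Adj G v w → Walk G u w (suc k)
  nil      ▻ b = cons b nil
  cons a p ▻ b = cons a (p ▻ b)

  _◅◅_ : ∀ {u v w k l} → Walk G u v k → Walk G v w l → Walk G u w (k + l)
  nil      ◅◅ q = q
  cons a p ◅◅ q = cons a (p ◅◅ q)

  Walk₀⇒≡ : ∀ {u v} → Walk G u v 0 → u ≡ v
  Walk₀⇒≡ nil = refl

  walk? : ∀ k u v → Dec (Walk G u v k)
  walk? zero u v with u ≟ᶠ v
  ... | yes refl = yes nil
  ... | no u≢v   = no (u≢v ∘ Walk₀⇒≡)
  walk? (suc k) u v with any? (λ w → T? (adj u w) ×-dec walk? k w v)
  ... | yes (w , a , p) = yes (cons a p)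
  ... | no none         = no λ { (cons a p) → none (_ , a , p) }

  Walk⇒IsDist : ∀ {u v k} → Walk G u v k → ∃[ d ] IsDist G u v d
  Walk⇒IsDist {u} {v} = least-witness (λ k → walk? k u v)

  IsDist-unique : ∀ {u v d d'} → IsDist G u v d → IsDist G u v d' → d ≡ d'
  IsDist-unique (p , p-min) (q , q-min) =
    ≤-antisym (≮⇒≥ λ d'<d → p-min _ d'<d q) (≮⇒≥ λ d<d' → q-min _ d<d' p)

  Connected⇒IsEcc : Connected G → ∀ v → ∃[ e ] IsEcc G v e
  Connected⇒IsEcc conn v =
    dist far , (λ u → dist u , f[xs]≤f[argmax] {f = dist} v (allFin n) ⟨lookup⟩ u , dist-spec u)
             , (far , dist-spec far)
    where
    dist-spec : ∀ u → IsDist G v u _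
    dist-spec u = proj₂ (Walk⇒IsDist (proj₂ (conn v u)))
    dist : Fin n → ℕ
    dist u = proj₁ (Walk⇒IsDist (proj₂ (conn v u)))
    far : Fin n
    far = argmax dist v (allFin n)
    _⟨lookup⟩_ : ∀ {P : Fin n → Set} → All P (allFin n) → ∀ u → P u
    ps ⟨lookup⟩ u = All.lookup ps (∈-allFin u)

  -- Positions past the end of a walk all name its endpoint.
  vertexAt : ∀ {u v k} → Walk G u v k → ℕ → Fin n
  vertexAt {u} p          zero    = u
  vertexAt {u} nil        (suc i) = u
  vertexAt     (cons _ p) (suc i) = vertexAt p i

  vertexAt-last : ∀ {u v k} (p : Walk G u v k) → 1 ≤ k → Step G (vertexAt p (k ∸ 1)) v
  vertexAt-last (cons a nil)        _ = inj₂ a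
  vertexAt-last (cons a (cons b p)) _ = vertexAt-last (cons b p) (s≤s z≤n)

  vertexAt-step : ∀ {u v k} (p : Walk G u v k) i → Step G (vertexAt p i) (vertexAt p (suc i))
  vertexAt-step nil        zero    = inj₁ refl
  vertexAt-step nil        (suc i) = inj₁ refl
  vertexAt-step (cons a p) zero    = inj₂ a
  vertexAt-step (cons a p) (suc i) = vertexAt-step p i

  take : ∀ {u v k} (p : Walk G u v k) i → i ≤ k → Walk G u (vertexAt p i) i
  take p          zero    _         = nil
  take (cons a p) (suc i) (s≤s i≤k) = cons a (take p i i≤k)

  drop : ∀ {u v k} (p : Walk G u v k) i → i ≤ k → Walk G (vertexAt p i) v (k ∸ i)
  drop p          zero    _         = p
  drop (cons a p) (suc i) (s≤s i≤k) = drop p i i≤k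

  IsDist-vertexAt : ∀ {u v e i} (g : IsDist G u v e) → i ≤ e → IsDist G u (vertexAt (proj₁ g) i) i
  IsDist-vertexAt {u} {e = e} {i} (p , p-min) i≤e = take p i i≤e , shorter-impossible
    where
    shorter-impossible : ∀ j → j < i → ¬ Walk G u (vertexAt p i) j
    shorter-impossible j j<i q = p-min (j + (e ∸ i)) shortcut (q ◅◅ drop p i i≤e)
      where
      shortcut : j + (e ∸ i) < e
      shortcut = subst (j + (e ∸ i) <_) (m+[n∸m]≡n i≤e) (+-monoˡ-< (e ∸ i) j<i)

  vertexAt-injective : ∀ {u v e i j} (g : IsDist G u v e) → i < j → j ≤ e →
                       vertexAt (proj₁ g) i ≢ vertexAt (proj₁ g) j
  vertexAt-injective {i = i} {j} g@(p , _) i<j j≤e eq =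
    proj₂ (IsDist-vertexAt g j≤e) i i<j
          (subst (λ x → Walk G _ x i) eq (take p i (≤-trans (<⇒≤ i<j) j≤e)))

  data Path : Fin n → List (Fin n) → Fin n → Set where
    end  : ∀ {a} → Path a (a ∷ []) a
    step : ∀ {a w b S} → Adj G a w → Path w S b → Path a (a ∷ S) b

  _▻ᴾ_ : ∀ {a b c S} → Path a S b → Adj G b c → Path a (S ∷ʳ c) c
  end      ▻ᴾ b = step b end
  step a p ▻ᴾ b = step a (p ▻ᴾ b)

  Path⇒Linked : ∀ {a b S} → Path a S b → Linked (Adj G) S
  Path⇒Linked end                   = [-]
  Path⇒Linked (step a end)          = a ∷ [-]
  Path⇒Linked (step a p@(step _ _)) = a ∷ Path⇒Linked p

  Path-length : ∀ {a b S} → Path a S b → a ≢ b → 2 ≤ length S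
  Path-length end                 a≢a = ⊥-elim (a≢a refl)
  Path-length (step _ end)        _   = s≤s (s≤s z≤n)
  Path-length (step _ (step _ _)) _   = s≤s (s≤s z≤n)

  close-cycle : ∀ {a b c S} → Path a S b → a ≢ b → Unique S → All (c ≢_) S →
                Adj G c a → Adj G b c → HasCycle G
  close-cycle {c = c} {S} p a≢b S-unique c∉S ca bc =
    c , S , Path-length p a≢b , c∉S ∷ S-unique , Path⇒Linked (step ca (p ▻ᴾ bc))

Unique-∷ʳ : ∀ {A : Set} {xs : List A} {x} → Unique xs → All (_≢ x) xs → Unique (xs ∷ʳ x)
Unique-∷ʳ xs-unique xs≢x =
  Unique.++⁺ xs-unique ([] ∷ []) λ { (v∈xs , here refl) → All.lookup xs≢x v∈xs refl }

module PlayFacts {G : Graph} (C : CopStrategy G) (R : RobberStrategy G) where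
  open Play G C R public
  open Walks G
  private
    module C = CopStrategy C
    module R = RobberStrategy R

  cop-move : ∀ i → cop (suc i) ≡ C.move i (proj₁ (history i)) (proj₂ (history i))
  cop-move i = last-∷ʳ _ (proj₁ (history i))

  robber-move : ∀ i → robber (suc i) ≡ R.move i (proj₁ (history (suc i))) (proj₂ (history i))
  robber-move i = last-∷ʳ _ (proj₂ (history i))

  cop-step : ∀ i → Step G (cop i) (cop (suc i))
  cop-step i = subst (Step G (cop i)) (sym (cop-move i)) (C.legal i _ _)

  robber-step : ∀ i → Step G (robber i) (robber (suc i))
  robber-step i = subst (Step G (robber i)) (sym (robber-move i)) (R.legal i _ _)

  cop-within : ∀ j → ∃[ k ] (k ≤ j × Walk G C.start (cop j) k)
  cop-within zero = 0 , z≤n , nil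
  cop-within (suc j) with cop-within j | cop-step j
  ... | k , k≤j , p | inj₁ eq = k , m≤n⇒m≤1+n k≤j , subst (λ x → Walk G C.start x k) eq p
  ... | k , k≤j , p | inj₂ a  = suc k , s≤s k≤j , p ▻ a

module FollowWalk {G : Graph} {u v k} (p : Walk G u v k) (s : ℕ) where
  open Walks G

  private
    next : ℕ → V G → V G
    next i x with x ≟ᶠ vertexAt p (s + i)
    ... | yes _ = vertexAt p (suc (s + i))
    ... | no _  = x

    next-legal : ∀ i x → Step G x (next i x)
    next-legal i x with x ≟ᶠ vertexAt p (s + i)
    ... | yes refl = vertexAt-step p (s + i)
    ... | no _     = inj₁ refl

    next-on-walk : ∀ i → next i (vertexAt p (s + i)) ≡ vertexAt p (suc (s + i))
    next-on-walk i with vertexAt p (s + i) ≟ᶠ vertexAt p (s + i)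
    ... | yes _  = refl
    ... | no x≢x = ⊥-elim (x≢x refl)

  strategy : RobberStrategy G
  strategy = record
    { start = λ _ → vertexAt p s
    ; move  = λ i _ rs → next i (last rs)
    ; legal = λ i _ rs → next-legal i (last rs)
    }

  robber-on-walk : ∀ C i → PlayFacts.robber C strategy i ≡ vertexAt p (s + i)
  robber-on-walk C zero    = cong (vertexAt p) (sym (+-identityʳ s))
  robber-on-walk C (suc i) = begin
    robber (suc i)               ≡⟨ robber-move i ⟩
    next i (robber i)            ≡⟨ cong (next i) (robber-on-walk C i) ⟩
    next i (vertexAt p (s + i))  ≡⟨ next-on-walk i ⟩
    vertexAt p (suc (s + i))     ≡⟨ cong (vertexAt p) (sym (+-suc s i)) ⟩
    vertexAt p (s + suc i)       ∎
    where
    open ≡-Reasoning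
    open PlayFacts C strategy

module RunAlongGeodesic {G : Graph} (C : CopStrategy G) {e}
                        (ecc : IsEcc G (CopStrategy.start C) e) where
  open Walks G

  private
    geodesic : IsDist G (CopStrategy.start C) (proj₁ (proj₂ ecc)) e
    geodesic = proj₂ (proj₂ ecc)

    q : ℕ → V G
    q = vertexAt (proj₁ geodesic)

  runner : RobberStrategy G
  runner = FollowWalk.strategy (proj₁ geodesic) 2

  open PlayFacts C runner

  private
    robber≡q : ∀ i → robber i ≡ q (2 + i)
    robber≡q = FollowWalk.robber-on-walk (proj₁ geodesic) 2 C

    cop-behind : ∀ {j m} → j < m → m ≤ e → cop j ≢ q m
    cop-behind {j} {m} j<m m≤e cop≡q with cop-within j
    ... | k , k≤j , p = proj₂ (IsDist-vertexAt geodesic m≤e) k (≤-<-trans k≤j j<m)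
                          (subst (λ x → Walk G _ x k) cop≡q p)

    damaged : ∀ i → 2 + i ≤ e → Damaged (robber i)
    damaged i 2+i≤e = i , refl , uncaught , escapes
      where
      uncaught : ∀ j → j ≤ i → cop j ≢ robber j
      uncaught j j≤i eq = cop-behind (n≤1+n _) (≤-trans (s≤s (s≤s j≤i)) 2+i≤e)
                                     (trans eq (robber≡q j))
      escapes : cop (suc i) ≢ robber i
      escapes eq = cop-behind ≤-refl 2+i≤e (trans eq (robber≡q i))

  runner-damages : ∀ {k} → k ≤ e ∸ 1 → AtLeastDamaged G C runner k
  runner-damages {k} k≤e∸1 =
    applyUpTo robber k , length-applyUpTo robber k ,
    Unique.applyUpTo⁺₁ robber k distinct , applyUpTo⁺₁ robber k (λ i<k → damaged _ (2+≤ i<k))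
    where
    2+≤ : ∀ {i} → i < k → 2 + i ≤ e
    2+≤ i<k = <∸1⇒2+≤ (<-≤-trans i<k k≤e∸1)
    distinct : ∀ {i j} → i < j → j < k → robber i ≢ robber j
    distinct i<j j<k eq = vertexAt-injective geodesic (s≤s (s≤s i<j)) (2+≤ j<k)
                            (trans (sym (robber≡q _)) (trans eq (robber≡q _)))

rad∸1-damage-forced : ∀ {G r} → Connected G → (∀ v e → IsEcc G v e → r ≤ e) →
              ∀ C → ∃[ R ] AtLeastDamaged G C R (r ∸ 1)
rad∸1-damage-forced {G} {r} conn rad-min C with Walks.Connected⇒IsEcc G conn (CopStrategy.start C)
... | e , ecc = runner , runner-damages (∸-monoˡ-≤ 1 (rad-min _ e ecc))
  where open RunAlongGeodesic C ecc

module RootedTree {G : Graph} (root : V G) {e} (ecc : IsEcc G root e)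
                  (acyclic : Acyclic G) where
  open Walks G

  level : V G → ℕ
  level x = proj₁ (proj₁ ecc x)

  level≤e : ∀ x → level x ≤ e
  level≤e x = proj₁ (proj₂ (proj₁ ecc x))

  level-spec : ∀ x → IsDist G root x (level x)
  level-spec x = proj₂ (proj₂ (proj₁ ecc x))

  level≡0⇒root : ∀ {x} → level x ≡ 0 → x ≡ root
  level≡0⇒root {x} eq = sym (Walk₀⇒≡ (subst (Walk G root x) eq (proj₁ (level-spec x))))

  level-adj : ∀ {x y} → Adj G x y → level x ≤ suc (level y)
  level-adj {x} {y} a = ≮⇒≥ λ lt → proj₂ (level-spec x) _ lt (proj₁ (level-spec y) ▻ Adj-sym a)

  parent : V G → V G
  parent x = vertexAt (proj₁ (level-spec x)) (level x ∸ 1)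

  level-parent : ∀ {x k} → level x ≡ suc k → level (parent x) ≡ k
  level-parent {x} eq =
    trans (IsDist-unique (level-spec (parent x)) (IsDist-vertexAt (level-spec x) (m∸n≤m _ 1)))
          (cong (_∸ 1) eq)

  parent-adj : ∀ {x k} → level x ≡ suc k → Adj G x (parent x)
  parent-adj {x} {k} eq with vertexAt-last (proj₁ (level-spec x)) (subst (1 ≤_) (sym eq) (s≤s z≤n))
  ... | inj₂ a = Adj-sym a
  ... | inj₁ parent≡x =
    ⊥-elim (1+n≢n (trans (sym eq) (trans (cong level (sym parent≡x)) (level-parent eq))))

  level-root : level root ≡ 0
  level-root = IsDist-unique (level-spec root) (nil , λ _ ())

  parent-above : ∀ {x v k} → level x ≡ suc k → suc k ≤ level v → parent x ≢ v
  parent-above x-level k<v refl = 1+n≰n (subst (_ ≤_) (level-parent x-level) k<v)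

  no-path-below-level : ∀ k {a b S} → level a ≡ k → level b ≡ k → a ≢ b → Path a S b →
                        Unique S → All (λ v → k ≤ level v) S → ⊥
  no-path-below-level zero a-level b-level a≢b _ _ _ =
    a≢b (trans (level≡0⇒root a-level) (sym (level≡0⇒root b-level)))
  no-path-below-level (suc k) {a} {b} {S} a-level b-level a≢b p S-unique below
    with parent a ≟ᶠ parent b
  ... | yes pa≡pb = acyclic (close-cycle p a≢b S-unique (All.map (parent-above a-level) below)
                      (Adj-sym (parent-adj a-level)) (subst (Adj G b) (sym pa≡pb) (parent-adj b-level)))
  ... | no pa≢pb  = no-path-below-level k (level-parent a-level) (level-parent b-level) pa≢pb
                      (step (Adj-sym (parent-adj a-level)) (p ▻ᴾ parent-adj b-level))
                      (∷ʳ⁺ (All.map (parent-above a-level) below) pa≢pb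
                        ∷ Unique-∷ʳ S-unique (All.map (λ k<v → parent-above b-level k<v ∘ sym) below))
                      (≤-reflexive (sym (level-parent a-level))
                        ∷ ∷ʳ⁺ (All.map (≤-trans (n≤1+n k)) below) (≤-reflexive (sym (level-parent b-level))))

  adjacent-levels : ∀ {x y} → Adj G x y → level y ≡ suc (level x) ⊎ level x ≡ suc (level y)
  adjacent-levels {x} {y} a with <-cmp (level x) (level y)
  ... | tri< x<y _ _ = inj₁ (≤-antisym (level-adj (Adj-sym a)) x<y)
  ... | tri> _ _ y<x = inj₂ (≤-antisym (level-adj a) y<x)
  ... | tri≈ _ x≡y _ = ⊥-elim (no-path-below-level (level x) refl (sym x≡y) x≢y (step a end)
                                 ((x≢y ∷ []) ∷ [] ∷ []) (≤-refl ∷ ≤-reflexive x≡y ∷ []))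
    where
    x≢y : x ≢ y
    x≢y refl = Adj-irrefl a

  parent-unique : ∀ {y a} → Adj G y a → level y ≡ suc (level a) → a ≡ parent y
  parent-unique {y} {a} ya y-level with a ≟ᶠ parent y
  ... | yes a≡p = a≡p
  ... | no a≢p  = ⊥-elim (no-path-below-level (level a) refl (level-parent y-level) a≢p
                    (step (Adj-sym ya) (step (parent-adj y-level) end))
                    ((a≢y ∷ a≢p ∷ []) ∷ (y≢p ∷ []) ∷ [] ∷ [])
                    (≤-refl ∷ ≤-trans (n≤1+n _) (≤-reflexive (sym y-level))
                       ∷ ≤-reflexive (sym (level-parent y-level)) ∷ []))
    where
    a≢y : a ≢ y
    a≢y a≡y = 1+n≢n (trans (sym y-level) (cong level (sym a≡y)))
    y≢p : y ≢ parent y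
    y≢p y≡p = 1+n≢n (trans (sym y-level) (trans (cong level y≡p) (level-parent y-level)))

  ancestor : ℕ → V G → V G
  ancestor zero    y = y
  ancestor (suc j) y = parent (ancestor j y)

  ancestor-suc : ∀ j y → ancestor (suc j) y ≡ ancestor j (parent y)
  ancestor-suc zero    y = refl
  ancestor-suc (suc j) y = cong parent (ancestor-suc j y)

  level-ancestor : ∀ j {t y} → level y ≡ j + t → level (ancestor j y) ≡ t
  level-ancestor zero    y-level = y-level
  level-ancestor (suc j) {t} y-level =
    level-parent (level-ancestor j (trans y-level (sym (+-suc j t))))

  Descendant : ℕ → V G → V G → Set
  Descendant t y z = level y ≡ level z + t × ancestor t y ≡ z

  root-ancestor : ∀ y → Descendant (level y) y root
  root-ancestor y = cong (_+ level y) (sym level-root) ,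
                    level≡0⇒root (level-ancestor (level y) (sym (+-identityʳ _)))

  descendant-step : ∀ {t y y' z} → Descendant (suc t) y z → Step G y y' → ∃[ s ] Descendant s y' z
  descendant-step {t} d (inj₁ refl) = suc t , d
  descendant-step {t} {y} {y'} {z} (y-level , y-anc) (inj₂ a) with adjacent-levels a
  ... | inj₁ y'-below = suc (suc t) , level-down , anc-down
    where
    open ≡-Reasoning
    level-down : level y' ≡ level z + suc (suc t)
    level-down = begin
      level y'                 ≡⟨ y'-below ⟩
      suc (level y)            ≡⟨ cong suc y-level ⟩
      suc (level z + suc t)    ≡⟨ sym (+-suc (level z) (suc t)) ⟩
      level z + suc (suc t)    ∎
    anc-down : ancestor (suc (suc t)) y' ≡ z
    anc-down = begin
      ancestor (suc (suc t)) y'    ≡⟨ ancestor-suc (suc t) y' ⟩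
      ancestor (suc t) (parent y') ≡⟨ cong (ancestor (suc t)) (sym (parent-unique (Adj-sym a) y'-below)) ⟩
      ancestor (suc t) y           ≡⟨ y-anc ⟩
      z                            ∎
  ... | inj₂ y-below = t , level-up , anc-up
    where
    open ≡-Reasoning
    level-up : level y' ≡ level z + t
    level-up = suc-injective (begin
      suc (level y')        ≡⟨ sym y-below ⟩
      level y               ≡⟨ y-level ⟩
      level z + suc t       ≡⟨ +-suc (level z) t ⟩
      suc (level z + t)     ∎)
    anc-up : ancestor t y' ≡ z
    anc-up = begin
      ancestor t y'         ≡⟨ cong (ancestor t) (parent-unique a y-below) ⟩
      ancestor t (parent y) ≡⟨ sym (ancestor-suc t y) ⟩
      ancestor (suc t) y    ≡⟨ y-anc ⟩
      z                     ∎

  level-toward : ∀ {t x y} → Descendant (suc t) y x → level (ancestor t y) ≡ suc (level x)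
  level-toward {t} {x} (y-level , _) =
    level-ancestor t (trans y-level (trans (+-comm (level x) (suc t)) (sym (+-suc t (level x)))))

  descendant-of-ancestor : ∀ {t x y} → Descendant (suc t) y x → Descendant t y (ancestor t y)
  descendant-of-ancestor {t} {x} d@(y-level , _) =
    trans y-level (trans (+-suc (level x) t) (cong (_+ t) (sym (level-toward d)))) , refl

module Chaser {G : Graph} (root : V G) {e} (ecc : IsEcc G root e) (acyclic : Acyclic G) where
  open Walks G
  open RootedTree root ecc acyclic

  -- The cop aims at the vertex one level below itself on the way to the robber.
  target : V G → V G → V G
  target x y = ancestor (level y ∸ suc (level x)) y

  target-near : ∀ {x y} → Step G x y → target x y ≡ y
  target-near {x} {y} s = cong (λ j → ancestor j y) (m≤n⇒m∸n≡0 (y≤1+x s))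
    where
    y≤1+x : Step G x y → level y ≤ suc (level x)
    y≤1+x (inj₁ refl) = n≤1+n _
    y≤1+x (inj₂ a)    = level-adj (Adj-sym a)

  target-below : ∀ {t x y} → Descendant (suc t) y x → target x y ≡ ancestor t y × Adj G x (ancestor t y)
  target-below {t} {x} {y} d@(y-level , y-anc) =
    cong (λ j → ancestor j y) lag ,
    subst (λ w → Adj G w (ancestor t y)) y-anc (Adj-sym (parent-adj (level-toward d)))
    where
    lag : level y ∸ suc (level x) ≡ t
    lag = trans (cong (_∸ suc (level x)) (trans y-level (+-suc (level x) t))) (m+n∸m≡n (level x) t)

  chase : V G → V G → V G
  chase x y with Step? x (target x y)
  ... | yes _ = target x y
  ... | no _  = x

  chase-legal : ∀ x y → Step G x (chase x y)
  chase-legal x y with Step? x (target x y)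
  ... | yes s = s
  ... | no _  = inj₁ refl

  chase-reaches : ∀ {x y} → Step G x (target x y) → chase x y ≡ target x y
  chase-reaches {x} {y} s with Step? x (target x y)
  ... | yes _ = refl
  ... | no ¬s = ⊥-elim (¬s s)

  chaser : CopStrategy G
  chaser = record
    { start = root
    ; move  = λ _ cs rs → chase (last cs) (last rs)
    ; legal = λ _ cs rs → chase-legal (last cs) (last rs)
    }

  module Chasing (R : RobberStrategy G) where
    open PlayFacts chaser R

    cop-catches-near : ∀ i → Step G (cop i) (robber i) → cop (suc i) ≡ robber i
    cop-catches-near i s = begin
      cop (suc i)                  ≡⟨ cop-move i ⟩
      chase (cop i) (robber i)     ≡⟨ chase-reaches (subst (Step G (cop i)) (sym (target-near s)) s) ⟩
      target (cop i) (robber i)    ≡⟨ target-near s ⟩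
      robber i                     ∎
      where open ≡-Reasoning

    cop-descends : ∀ i {t} → Descendant (suc t) (robber i) (cop i) →
                   level (cop (suc i)) ≡ suc (level (cop i)) × Descendant t (robber i) (cop (suc i))
    cop-descends i d with target-below d
    ... | target≡z , a = subst (λ w → level w ≡ _) (sym cop≡z) (level-toward d) ,
                         subst (Descendant _ (robber i)) (sym cop≡z) (descendant-of-ancestor d)
      where
      cop≡z : cop (suc i) ≡ _
      cop≡z = trans (cop-move i)
                    (trans (chase-reaches (subst (Step G (cop i)) (sym target≡z) (inj₂ a))) target≡z)

    Invariant : ℕ → Set
    Invariant i = Step G (cop i) (robber i) ⊎ (level (cop i) ≡ i × ∃[ t ] Descendant t (robber i) (cop i))

    near-step : ∀ i → Step G (cop i) (robber i) → Step G (cop (suc i)) (robber (suc i))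
    near-step i s = subst (λ x → Step G x (robber (suc i))) (sym (cop-catches-near i s)) (robber-step i)

    invariant : ∀ i → Invariant i
    invariant zero = inj₂ (level-root , level (robber 0) , root-ancestor (robber 0))
    invariant (suc i) with invariant i
    ... | inj₁ s                         = inj₁ (near-step i s)
    ... | inj₂ (_ , zero , _ , robber≡cop) = inj₁ (near-step i (inj₁ (sym robber≡cop)))
    ... | inj₂ (_ , suc zero , d)        =
      inj₁ (subst (λ x → Step G x (robber (suc i))) (proj₂ (proj₂ (cop-descends i d))) (robber-step i))
    ... | inj₂ (cop-level , suc (suc t) , d) with cop-descends i d
    ...   | next-level , d' = inj₂ (trans next-level (cong suc cop-level) , descendant-step d' (robber-step i))

    damage-early : ∀ i → cop (suc i) ≢ robber i → i < e ∸ 1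
    damage-early i escapes with invariant i
    ... | inj₁ s                         = ⊥-elim (escapes (cop-catches-near i s))
    ... | inj₂ (_ , zero , _ , robber≡cop) =
      ⊥-elim (escapes (cop-catches-near i (inj₁ (sym robber≡cop))))
    ... | inj₂ (_ , suc zero , d)        = ⊥-elim (escapes (sym (proj₂ (proj₂ (cop-descends i d)))))
    ... | inj₂ (cop-level , suc (suc t) , robber-level , _) =
      2+≤⇒<∸1 (≤-trans robber-deep (level≤e (robber i)))
      where
      open ≤-Reasoning
      robber-deep : 2 + i ≤ level (robber i)
      robber-deep = begin
        2 + i                      ≤⟨ s≤s (s≤s (m≤m+n i t)) ⟩
        2 + (i + t)                ≡⟨ sym (trans (+-suc i (suc t)) (cong suc (+-suc i t))) ⟩
        i + suc (suc t)            ≡⟨ cong (_+ suc (suc t)) (sym cop-level) ⟩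
        level (cop i) + suc (suc t) ≡⟨ sym robber-level ⟩
        level (robber i)           ∎

    at-most-damaged : AtMostDamaged G chaser R (e ∸ 1)
    at-most-damaged =
      applyUpTo robber (e ∸ 1) , ≤-reflexive (length-applyUpTo robber (e ∸ 1)) ,
      λ { _ (i , refl , _ , escapes) → ∈-applyUpTo⁺ robber (damage-early i escapes) }

corollary12 : (T : Graph) → IsTree T → (r : ℕ) → IsRadius T r → DmgIs T (r ∸ 1)
corollary12 T (_ , connected , acyclic) r ((center , ecc) , rad-min) =
  (chaser , Chasing.at-most-damaged) , rad∸1-damage-forced connected rad-min
  where open Chaser center ecc acyclic
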